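{- For every integer $r$, \[ 4K_{r}^2 =5T_{r+5}^2-20T_{r+4}^2+4T_{r+3}^2+90T_{r+1}^2-20T_{r}^2+5T_{r-3}^2, \] where $(T_r)$ are the Tribonacci numbers and $(K_r)$ the Tribonacci-Lucas numbers.
   Context: Sequences $(X_r)_{r\in\mathbb{Z}}$ satisfying $X_r=X_{r-1}+X_{r-2}+X_{r-3}$ for all integers $r$ (defined forward for $r\ge3$ and backward by $X_{ -r}=X_{ -r+3}-X_{ -r+2}-X_{ -r+1}$). The Tribonacci numbers $T_r$ have $T_0=0$, $T_1=T_2=1$; the Tribonacci-Lucas numbers $K_r$ have $K_0=3$, $K_1=1$, $K_2=3$. -}

module Defs where

open import Data.Nat using (ℕ; zero; suc)
open import Data.Integer using (ℤ; +_; -[1+_]; _+_; _-_)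
open import Data.Product using (_×_; _,_; proj₁)

-- Triples (a , b , c) standing for consecutive terms (X_m , X_{m+1} , X_{m+2}).
Triple : Set
Triple = ℤ × ℤ × ℤ

fwd : ℕ → Triple → Triple
fwd zero    t = t
fwd (suc n) (a , b , c) = fwd n (b , c , a + b + c)

bwd : ℕ → Triple → Triple
bwd zero    t = t
bwd (suc n) (a , b , c) = bwd n (c - b - a , a , b)

-- The sequence X : ℤ → ℤ with X_0 = x0, X_1 = x1, X_2 = x2 and
-- X_r = X_{r-1} + X_{r-2} + X_{r-3} for all integers r.
seq3 : ℤ → ℤ → ℤ → ℤ → ℤ
seq3 x0 x1 x2 (+ n)      = proj₁ (fwd n (x0 , x1 , x2))
seq3 x0 x1 x2 (-[1+ n ]) = proj₁ (bwd (suc n) (x0 , x1 , x2))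

T : ℤ → ℤ
T = seq3 (+ 0) (+ 1) (+ 1)

K : ℤ → ℤ
K = seq3 (+ 3) (+ 1) (+ 3)

-- Both sides only involve T at the nine consecutive indices r - 3, …, r + 5, and
-- K_m = - T_m + 4 T_{m+1} - T_{m+2} (both sides solve the recurrence and agree at
-- m = 0, 1, 2).  Writing everything in terms of the window (T_{r-3}, T_{r-2}, T_{r-1})
-- turns the theorem into a polynomial identity in three variables.
module Submission where

open import Defs
open import Data.Nat as ℕ using (zero; suc)
import Data.Nat.Properties as ℕ
open import Data.Integer using (ℤ; +_; -[1+_]; _+_; _-_; _*_; -_)
open import Data.Integer.Properties using (+-identityʳ)
open import Data.Integer.Tactic.RingSolver using (solve-∀)
open import Data.Product using (_,_; proj₁)
open import Relation.Binary.PropositionalEquality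
  using (_≡_; refl; sym; trans; cong; module ≡-Reasoning)

open ≡-Reasoning

step : Triple → Triple
step (a , b , c) = (b , c , a + b + c)

back : Triple → Triple
back (a , b , c) = (c - b - a , a , b)

step-back : ∀ t → step (back t) ≡ t
step-back (a , b , c) = cong (λ z → (a , b , z)) (lemma a b c)
  where
  lemma : ∀ a b c → c - b - a + a + b ≡ c
  lemma = solve-∀

back-step : ∀ t → back (step t) ≡ t
back-step (a , b , c) = cong (λ z → (z , b , c)) (lemma a b c)
  where
  lemma : ∀ a b c → a + b + c - c - b ≡ a
  lemma = solve-∀

step-injective : ∀ {t u} → step t ≡ step u → t ≡ u
step-injective {t} {u} eq = begin
  t               ≡⟨ sym (back-step t) ⟩
  back (step t)   ≡⟨ cong back eq ⟩
  back (step u)   ≡⟨ back-step u ⟩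
  u               ∎

Commute : (Triple → Triple) → (Triple → Triple) → Set
Commute f g = ∀ t → f (g t) ≡ g (f t)

back-commutes : ∀ f → Commute f step → Commute f back
back-commutes f comm t = step-injective (begin
  step (f (back t))   ≡⟨ sym (comm (back t)) ⟩
  f (step (back t))   ≡⟨ cong f (step-back t) ⟩
  f t                 ≡⟨ sym (step-back (f t)) ⟩
  step (back (f t))   ∎)

fwd-commutes : ∀ f → Commute f step → ∀ n → Commute f (fwd n)
fwd-commutes f comm zero    t = refl
fwd-commutes f comm (suc n) t = trans (fwd-commutes f comm n (step t)) (cong (fwd n) (comm t))

bwd-commutes : ∀ f → Commute f back → ∀ n → Commute f (bwd n)
bwd-commutes f comm zero    t = refl
bwd-commutes f comm (suc n) t = trans (bwd-commutes f comm n (back t)) (cong (bwd n) (comm t))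

fwd-suc : ∀ n t → fwd (suc n) t ≡ step (fwd n t)
fwd-suc n t = sym (fwd-commutes step (λ _ → refl) n t)

bwd-suc : ∀ n t → bwd (suc n) t ≡ back (bwd n t)
bwd-suc n t = sym (bwd-commutes back (λ _ → refl) n t)

-- window t r = (X_r, X_{r+1}, X_{r+2}) for the solution X with initial window t.
window : Triple → ℤ → Triple
window t (+ n)      = fwd n t
window t -[1+ n ]   = bwd (suc n) t

seq3-window : ∀ x0 x1 x2 r → seq3 x0 x1 x2 r ≡ proj₁ (window (x0 , x1 , x2) r)
seq3-window x0 x1 x2 (+ n)    = refl
seq3-window x0 x1 x2 -[1+ n ] = refl

window-suc : ∀ t r → window t (r + + 1) ≡ step (window t r)
window-suc t (+ n) rewrite ℕ.+-comm n 1 = fwd-suc n t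
window-suc t -[1+ zero ]  = sym (step-back t)
window-suc t -[1+ suc m ] = sym (begin
  step (bwd (suc m) (back t))   ≡⟨ cong step (bwd-suc m (back t)) ⟩
  step (back (bwd m (back t)))  ≡⟨ step-back (bwd m (back t)) ⟩
  bwd (suc m) t                 ∎)

window-+ : ∀ t r k → window t (r + + k) ≡ fwd k (window t r)
window-+ t r zero    = cong (window t) (+-identityʳ r)
window-+ t r (suc k) = begin
  window t (r + + suc k)        ≡⟨ cong (window t) (+-suc r (+ k)) ⟩
  window t (r + + k + + 1)      ≡⟨ window-suc t (r + + k) ⟩
  step (window t (r + + k))     ≡⟨ cong step (window-+ t r k) ⟩
  step (fwd k (window t r))     ≡⟨ sym (fwd-suc k (window t r)) ⟩
  fwd (suc k) (window t r)      ∎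
  where
  +-suc : ∀ r x → r + (+ 1 + x) ≡ r + x + + 1
  +-suc = solve-∀

window-commutes : ∀ f → Commute f step → ∀ t r → f (window t r) ≡ window (f t) r
window-commutes f comm t (+ n)    = fwd-commutes f comm n t
window-commutes f comm t -[1+ n ] = bwd-commutes f (back-commutes f comm) (suc n) t

linear : ℤ → ℤ → ℤ → Triple → ℤ
linear p q s (a , b , c) = p * a + q * b + s * c

-- Sends the window of X at m to the window of m ↦ ℓ (window of X at m).
map-windows : (Triple → ℤ) → Triple → Triple
map-windows ℓ t = (ℓ t , ℓ (step t) , ℓ (step (step t)))

map-windows-linear-commutes : ∀ p q s → Commute (map-windows (linear p q s)) step
map-windows-linear-commutes p q s t@(a , b , c) =
  cong (λ z → (ℓ (step t) , ℓ (step (step t)) , z)) (lemma p q s a b c)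
  where
  ℓ = linear p q s
  lemma : ∀ p q s a b c →
    let d = a + b + c; e = b + c + d; f = c + d + e
    in p * d + q * e + s * f
       ≡ (p * a + q * b + s * c) + (p * b + q * c + s * d) + (p * c + q * d + s * e)
  lemma = solve-∀

tribonacci-window : Triple
tribonacci-window = (+ 0 , + 1 , + 1)

lucas-form : Triple → ℤ
lucas-form = linear (- + 1) (+ 4) (- + 1)

-- The initial window (3, 1, 3) of K is map-windows lucas-form tribonacci-window
-- by computation.
K≡lucas-form-T : ∀ r → K r ≡ lucas-form (window tribonacci-window r)
K≡lucas-form-T r = trans (seq3-window (+ 3) (+ 1) (+ 3) r) (cong proj₁ (sym
  (window-commutes (map-windows lucas-form)
    (map-windows-linear-commutes (- + 1) (+ 4) (- + 1)) tribonacci-window r)))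

window-ahead : ∀ t r k → window t (r + + k) ≡ fwd (3 ℕ.+ k) (window t (r - + 3))
window-ahead t r k = trans (cong (window t) (lemma r (+ k))) (window-+ t (r - + 3) (3 ℕ.+ k))
  where
  lemma : ∀ r x → r + x ≡ r - + 3 + (+ 3 + x)
  lemma = solve-∀

window-at : ∀ t r → window t r ≡ fwd 3 (window t (r - + 3))
window-at t r = trans (cong (window t) (sym (+-identityʳ r))) (window-ahead t r 0)

T-ahead : ∀ r k → T (r + + k) ≡ proj₁ (fwd (3 ℕ.+ k) (window tribonacci-window (r - + 3)))
T-ahead r k = trans (seq3-window (+ 0) (+ 1) (+ 1) (r + + k))
  (cong proj₁ (window-ahead tribonacci-window r k))

T-at : ∀ r → T r ≡ proj₁ (fwd 3 (window tribonacci-window (r - + 3)))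
T-at r = trans (seq3-window (+ 0) (+ 1) (+ 1) r) (cong proj₁ (window-at tribonacci-window r))

window-identity : ∀ w →
  let lookup k = proj₁ (fwd k w)
  in + 4 * (lucas-form (fwd 3 w) * lucas-form (fwd 3 w))
     ≡ + 5 * (lookup 8 * lookup 8) - + 20 * (lookup 7 * lookup 7)
       + + 4 * (lookup 6 * lookup 6) + + 90 * (lookup 4 * lookup 4)
       - + 20 * (lookup 3 * lookup 3) + + 5 * (lookup 0 * lookup 0)
window-identity (a , b , c) = polynomial-identity a b c
  where
  polynomial-identity : ∀ a b c →
    let d = a + b + c; e = b + c + d; f = c + d + e; g = d + e + f; h = e + f + g; k = f + g + h
    in + 4 * ((- + 1 * d + + 4 * e + - + 1 * f) * (- + 1 * d + + 4 * e + - + 1 * f))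
       ≡ + 5 * (k * k) - + 20 * (h * h) + + 4 * (g * g) + + 90 * (e * e)
         - + 20 * (d * d) + + 5 * (a * a)
  polynomial-identity = solve-∀

theorem6 : (r : ℤ) →
    + 4 * (K r * K r)
      ≡ + 5 * (T (r + + 5) * T (r + + 5)) - + 20 * (T (r + + 4) * T (r + + 4))
        + + 4 * (T (r + + 3) * T (r + + 3)) + + 90 * (T (r + + 1) * T (r + + 1))
        - + 20 * (T r * T r) + + 5 * (T (r - + 3) * T (r - + 3))
theorem6 r
  rewrite K≡lucas-form-T r
        | window-at tribonacci-window r
        | T-ahead r 5 | T-ahead r 4 | T-ahead r 3 | T-ahead r 1 | T-at r
        | seq3-window (+ 0) (+ 1) (+ 1) (r - + 3)
  = window-identity (window tribonacci-window (r - + 3))
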